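{- Let $r_2\ge 4$ be an even integer. Then there is no finite simple graph with parameters $(r_2,r_3)$ for any integer $r_3$ satisfying either $4\binom{r_2/2}{2}<r_3<\binom{r_2}{2}$ or $\binom{r_2-1}{2}<r_3<4\binom{r_2/2}{2}$. Moreover, $K_{r_2+1}$ has parameters $\bigl(r_2,\binom{r_2}{2}\bigr)$, $\operatorname{Turan}(r_2+2,\ r_2/2+1)$ has parameters $\bigl(r_2,4\binom{r_2/2}{2}\bigr)$, and $K_{r_2}\square K_2$ has parameters $\bigl(r_2,\binom{r_2-1}{2}\bigr)$.
   Context: For a vertex $v$, its $K_3$-degree is the number of triangles of the graph containing $v$. A graph has parameters $(r_2,r_3)$ if every vertex has degree $r_2$ and every vertex has $K_3$-degree $r_3$. $K_n$ is the complete graph on $n$ vertices. For $r\mid n$, $\operatorname{Turan}(n,r)$ is the complete $r$-partite graph on $n$ vertices with all parts of size $n/r$ (vertices adjacent iff they lie in different parts). $G\square H$ is the Cartesian product: vertex set $V(G)\times V(H)$, with $(u,v)\sim(u',v')$ iff ($u=u'$ and $vv'\in E(H)$) or ($v=v'$ and $uu'\in E(G)$). -}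

module Defs where

open import Data.Nat using (ℕ; zero; suc; _+_; _*_; _%_; _≡ᵇ_; _<ᵇ_)
open import Data.Bool using (Bool; true; false; if_then_else_; _∧_; _∨_; not)
open import Data.Fin using (Fin; toℕ; remQuot)
open import Data.Product using (_×_; _,_; proj₁; proj₂; Σ)
open import Relation.Binary.PropositionalEquality using (_≡_)

record Graph (n : ℕ) : Set where
  field
    adj    : Fin n → Fin n → Bool
    sym    : ∀ u v → adj u v ≡ adj v u
    irrefl : ∀ v → adj v v ≡ false
open Graph public

count : ∀ {n} → (Fin n → Bool) → ℕ
count {zero}  p = 0
count {suc n} p = (if p Fin.zero then 1 else 0) + count (λ i → p (Fin.suc i))

sumFin : ∀ {n} → (Fin n → ℕ) → ℕ
sumFin {zero}  f = 0
sumFin {suc n} f = f Fin.zero + sumFin (λ i → f (Fin.suc i))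

degree : ∀ {n} → Graph n → Fin n → ℕ
degree G v = count (adj G v)

-- K3-degree of v: number of triangles {v,u,w} containing v,
-- each counted once via the ordered pair u < w
K3degree : ∀ {n} → Graph n → Fin n → ℕ
K3degree G v = sumFin λ u → count λ w →
  adj G v u ∧ adj G v w ∧ adj G u w ∧ (toℕ u <ᵇ toℕ w)

HasParams : ∀ {n} → Graph n → ℕ → ℕ → Set
HasParams {n} G r₂ r₃ = ∀ (v : Fin n) → degree G v ≡ r₂ × K3degree G v ≡ r₃

_==_ : ∀ {n} → Fin n → Fin n → Bool
i == j = toℕ i ≡ᵇ toℕ j

K : (n : ℕ) → Graph n
K n = record { adj = λ u v → not (u == v) ; sym = s ; irrefl = ir }
  where
  open import Data.Nat.Properties using (≡ᵇ⇒≡; ≡⇒≡ᵇ)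
  open import Relation.Binary.PropositionalEquality using (refl; cong)
  eqsym : ∀ (a b : ℕ) → (a ≡ᵇ b) ≡ (b ≡ᵇ a)
  eqsym zero zero = refl
  eqsym zero (suc b) = refl
  eqsym (suc a) zero = refl
  eqsym (suc a) (suc b) = eqsym a b
  s : ∀ (u v : Fin n) → not (u == v) ≡ not (v == u)
  s u v = cong not (eqsym (toℕ u) (toℕ v))
  eqrefl : ∀ (a : ℕ) → (a ≡ᵇ a) ≡ true
  eqrefl zero = refl
  eqrefl (suc a) = eqrefl a
  ir : ∀ (v : Fin n) → not (v == v) ≡ false
  ir v = cong not (eqrefl (toℕ v))

-- Turan(n, r) for r ≥ 1 (used with r ∣ n): vertex i lies in part (i mod r),
-- so all r parts have size n/r; adjacent iff in different parts.
Turan : (n r : ℕ) → Graph n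
Turan n zero = K n   -- degenerate case, never used (r ≥ 1 below)
Turan n (suc r) = record
  { adj = λ u v → not ((toℕ u % suc r) ≡ᵇ (toℕ v % suc r)) ; sym = s ; irrefl = ir }
  where
  open import Relation.Binary.PropositionalEquality using (refl; cong)
  eqsym : ∀ (a b : ℕ) → (a ≡ᵇ b) ≡ (b ≡ᵇ a)
  eqsym zero zero = refl
  eqsym zero (suc b) = refl
  eqsym (suc a) zero = refl
  eqsym (suc a) (suc b) = eqsym a b
  eqrefl : ∀ (a : ℕ) → (a ≡ᵇ a) ≡ true
  eqrefl zero = refl
  eqrefl (suc a) = eqrefl a
  s : ∀ (u v : Fin n) → not ((toℕ u % suc r) ≡ᵇ (toℕ v % suc r)) ≡ not ((toℕ v % suc r) ≡ᵇ (toℕ u % suc r))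
  s u v = cong not (eqsym (toℕ u % suc r) (toℕ v % suc r))
  ir : ∀ (v : Fin n) → not ((toℕ v % suc r) ≡ᵇ (toℕ v % suc r)) ≡ false
  ir v = cong not (eqrefl (toℕ v % suc r))

-- Cartesian product G □ H, with vertex set Fin (m * n) ≅ Fin m × Fin n via remQuot
_□_ : ∀ {m n} → Graph m → Graph n → Graph (m * n)
_□_ {m} {n} G H = record { adj = a ; sym = s ; irrefl = ir }
  where
  open import Relation.Binary.PropositionalEquality using (refl; cong; cong₂)
  eqsym : ∀ (a b : ℕ) → (a ≡ᵇ b) ≡ (b ≡ᵇ a)
  eqsym zero zero = refl
  eqsym zero (suc b) = refl
  eqsym (suc a) zero = refl
  eqsym (suc a) (suc b) = eqsym a b
  eqrefl : ∀ (a : ℕ) → (a ≡ᵇ a) ≡ true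
  eqrefl zero = refl
  eqrefl (suc a) = eqrefl a
  a' : Fin m × Fin n → Fin m × Fin n → Bool
  a' (u , v) (u' , v') = ((u == u') ∧ adj H v v') ∨ ((v == v') ∧ adj G u u')
  a : Fin (m * n) → Fin (m * n) → Bool
  a x y = a' (remQuot n x) (remQuot n y)
  s' : ∀ p q → a' p q ≡ a' q p
  s' (u , v) (u' , v') = cong₂ _∨_ (cong₂ _∧_ (eqsym (toℕ u) (toℕ u')) (sym H v v'))
                                  (cong₂ _∧_ (eqsym (toℕ v) (toℕ v')) (sym G u u'))
  s : ∀ x y → a x y ≡ a y x
  s x y = s' (remQuot n x) (remQuot n y)
  ir' : ∀ p → a' p p ≡ false
  ir' (u , v) rewrite eqrefl (toℕ u) | eqrefl (toℕ v) | irrefl H v | irrefl G u = refl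
  ir : ∀ x → a x x ≡ false
  ir x = ir' (remQuot n x)

-- In a d-regular graph write privateDegree v x = |N(v) ∖ N[x]| and let privateSum v be
-- its sum over the neighbours x of v: the number of ordered pairs of distinct,
-- non-adjacent neighbours of v.  Counting pairs of neighbours gives
-- 2·K3degree v + privateSum v = d(d − 1), so constant K3-degree r makes privateSum a
-- constant M.  For an edge vu with a = privateDegree v u (= privateDegree u v by
-- regularity) and λ common neighbours, counting the non-edges in the links of v and u
-- gives (2 + λ)·a ≤ M, while d = λ + 1 + a.  Hence either every a is 0 (M = 0 and
-- r = C(d,2)), or every a is at most 1 and some a is 1 (M = d, which for d = 2k means
-- r = 4·C(k,2)), or some a ≥ 2 and M ≥ 2(d − 1), i.e. r ≤ C(d − 1, 2).  The three
-- values are attained by K_{d+1}, the cocktail-party graph Turan(d + 2, k + 1) and the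
-- prism K_d □ K_2, whose private degrees are 0, 1, and 1 or d − 1 respectively.

module Submission where

open import Defs
open import Data.Bool using (Bool; true; false; if_then_else_; _∧_; _∨_; not; T)
open import Data.Bool.Properties using (∧-assoc; ∧-comm; ∧-zeroʳ; ∧-identityʳ; ∨-zeroʳ; ¬-not) renaming (_≟_ to _≟ᵇ_)
open import Data.Empty using (⊥-elim)
open import Data.Fin using (Fin; toℕ; _↑ˡ_; _↑ʳ_; remQuot; combine)
open import Data.Fin.Properties
  using (toℕ-injective; toℕ-↑ˡ; toℕ-↑ʳ; toℕ<n; splitAt-↑ˡ; splitAt-↑ʳ; combine-remQuot; all?; ¬∀⟶∃¬)
open import Data.Nat using (ℕ; zero; suc; _+_; _*_; _∸_; _≤_; _<_; z≤n; s≤s; _≡ᵇ_; _<ᵇ_; _%_)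
open import Data.Nat.Combinatorics using (_C_; nCk+nC[k+1]≡[n+1]C[k+1]; nC1≡n)
open import Data.Nat.DivMod using (m<n⇒m%n≡m; [m+n]%n≡m%n; m%n<n)
open import Data.Nat.Properties
open import Algebra.Properties.CommutativeSemigroup +-commutativeSemigroup using (interchange)
open import Data.Nat.Tactic.RingSolver using (solve-∀)
open import Data.Product using (_×_; _,_; proj₁; proj₂; Σ; uncurry)
open import Data.Sum using (_⊎_; inj₁; inj₂)
open import Function using (_∘_)
open import Relation.Nullary using (¬_; Dec; yes; no)
open import Relation.Nullary.Decidable using (_→-dec_)
open import Relation.Binary.PropositionalEquality
  using (_≡_; _≢_; refl; cong; cong₂; trans; subst; subst₂; module ≡-Reasoning)
  renaming (sym to ≡-sym)

χ : Bool → ℕ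
χ b = if b then 1 else 0

≡ᵇ-refl : ∀ a → (a ≡ᵇ a) ≡ true
≡ᵇ-refl zero    = refl
≡ᵇ-refl (suc a) = ≡ᵇ-refl a

≡ᵇ-sym : ∀ a b → (a ≡ᵇ b) ≡ (b ≡ᵇ a)
≡ᵇ-sym zero    zero    = refl
≡ᵇ-sym zero    (suc b) = refl
≡ᵇ-sym (suc a) zero    = refl
≡ᵇ-sym (suc a) (suc b) = ≡ᵇ-sym a b

≡ᵇ⇒≡′ : ∀ {a b} → (a ≡ᵇ b) ≡ true → a ≡ b
≡ᵇ⇒≡′ {a} {b} e = ≡ᵇ⇒≡ a b (subst T (≡-sym e) _)

==-refl : ∀ {n} (i : Fin n) → (i == i) ≡ true
==-refl i = ≡ᵇ-refl (toℕ i)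

==-sym : ∀ {n} (i j : Fin n) → (i == j) ≡ (j == i)
==-sym i j = ≡ᵇ-sym (toℕ i) (toℕ j)

==⇒≡ : ∀ {n} {i j : Fin n} → (i == j) ≡ true → i ≡ j
==⇒≡ e = toℕ-injective (≡ᵇ⇒≡′ e)

<ᵇ-flip : ∀ m n → m ≢ n → (m <ᵇ n) ≡ not (n <ᵇ m)
<ᵇ-flip zero    zero    m≢n = ⊥-elim (m≢n refl)
<ᵇ-flip zero    (suc n) _   = refl
<ᵇ-flip (suc m) zero    _   = refl
<ᵇ-flip (suc m) (suc n) m≢n = <ᵇ-flip m n (λ e → m≢n (cong suc e))

∧-not-∨ : ∀ a b c → (a ∧ not b) ∧ not c ≡ a ∧ not (c ∨ b)
∧-not-∨ false b c     = refl
∧-not-∨ true  b false = ∧-identityʳ (not b)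
∧-not-∨ true  b true  = ∧-zeroʳ (not b)

χ-split-ordered : ∀ a b c l l' → (c ≡ true → l ≡ not l') → χ (a ∧ b ∧ c) ≡ χ (a ∧ b ∧ c ∧ l) + χ (b ∧ a ∧ c ∧ l')
χ-split-ordered false false c     l l' h = refl
χ-split-ordered false true  c     l l' h = refl
χ-split-ordered true  false c     l l' h = refl
χ-split-ordered true  true  false l l' h = refl
χ-split-ordered true  true  true  l l' h rewrite h refl with l'
... | true  = refl
... | false = refl

-- Sums and counts over Fin n

sumFin-cong : ∀ {n} {f g : Fin n → ℕ} → (∀ i → f i ≡ g i) → sumFin f ≡ sumFin g
sumFin-cong {zero}  e = refl
sumFin-cong {suc n} e = cong₂ _+_ (e Fin.zero) (sumFin-cong (λ i → e (Fin.suc i)))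

sumFin-mono : ∀ {n} {f g : Fin n → ℕ} → (∀ i → f i ≤ g i) → sumFin f ≤ sumFin g
sumFin-mono {zero}  e = z≤n
sumFin-mono {suc n} e = +-mono-≤ (e Fin.zero) (sumFin-mono (λ i → e (Fin.suc i)))

sumFin-+ : ∀ {n} (f g : Fin n → ℕ) → sumFin (λ i → f i + g i) ≡ sumFin f + sumFin g
sumFin-+ {zero}  f g = refl
sumFin-+ {suc n} f g =
  trans (cong (f Fin.zero + g Fin.zero +_) (sumFin-+ (λ i → f (Fin.suc i)) (λ i → g (Fin.suc i))))
        (interchange (f Fin.zero) (g Fin.zero) _ _)

sumFin-const : ∀ {n} c → sumFin {n} (λ _ → c) ≡ n * c
sumFin-const {zero}  c = refl
sumFin-const {suc n} c = cong (c +_) (sumFin-const {n} c)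

sumFin-zero : ∀ {n} → sumFin {n} (λ _ → 0) ≡ 0
sumFin-zero {n} = trans (sumFin-const {n} 0) (*-zeroʳ n)

sumFin-swap : ∀ {m n} (f : Fin m → Fin n → ℕ) →
  sumFin (λ i → sumFin (f i)) ≡ sumFin (λ j → sumFin (λ i → f i j))
sumFin-swap {zero}  {n} f = ≡-sym (sumFin-zero {n})
sumFin-swap {suc m} {n} f =
  trans (cong (sumFin (f Fin.zero) +_) (sumFin-swap (λ i → f (Fin.suc i))))
        (≡-sym (sumFin-+ (f Fin.zero) _))

sumFin-if : ∀ {n} (p : Fin n → Bool) c → sumFin (λ i → if p i then c else 0) ≡ count p * c
sumFin-if {zero}  p c = refl
sumFin-if {suc n} p c with p Fin.zero
... | true  = cong (c +_) (sumFin-if (λ i → p (Fin.suc i)) c)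
... | false = sumFin-if (λ i → p (Fin.suc i)) c

sumFin-point : ∀ {n} (x : Fin n) (f : Fin n → ℕ) → sumFin (λ i → if i == x then f i else 0) ≡ f x
sumFin-point {suc n} Fin.zero    f = trans (cong (f Fin.zero +_) (sumFin-zero {n})) (+-identityʳ _)
sumFin-point {suc n} (Fin.suc x) f = sumFin-point x (λ i → f (Fin.suc i))

count≡sumFin : ∀ {n} (p : Fin n → Bool) → count p ≡ sumFin (λ i → χ (p i))
count≡sumFin {zero}  p = refl
count≡sumFin {suc n} p = cong (χ (p Fin.zero) +_) (count≡sumFin (λ i → p (Fin.suc i)))

count-cong : ∀ {n} {p q : Fin n → Bool} → (∀ i → p i ≡ q i) → count p ≡ count q
count-cong {zero}  e = refl
count-cong {suc n} e = cong₂ _+_ (cong χ (e Fin.zero)) (count-cong (λ i → e (Fin.suc i)))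

count-mono : ∀ {n} {p q : Fin n → Bool} → (∀ i → p i ≡ true → q i ≡ true) → count p ≤ count q
count-mono {zero}          h = z≤n
count-mono {suc n} {p} {q} h = +-mono-≤ (χ-mono (p Fin.zero) (q Fin.zero) (h Fin.zero)) (count-mono (λ i → h (Fin.suc i)))
  where
  χ-mono : ∀ a b → (a ≡ true → b ≡ true) → χ a ≤ χ b
  χ-mono false b  _ = z≤n
  χ-mono true  b  h rewrite h refl = ≤-refl

count-split : ∀ {n} (p q : Fin n → Bool) → count p ≡ count (λ i → p i ∧ q i) + count (λ i → p i ∧ not (q i))
count-split {zero}  p q = refl
count-split {suc n} p q with p Fin.zero | q Fin.zero | count-split (λ i → p (Fin.suc i)) (λ i → q (Fin.suc i))
... | false | _     | r = r
... | true  | true  | r = cong suc r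
... | true  | false | r = trans (cong suc r) (≡-sym (+-suc _ _))

count-false : ∀ {n} → count {n} (λ _ → false) ≡ 0
count-false {zero}  = refl
count-false {suc n} = count-false {n}

count-true : ∀ {n} → count {n} (λ _ → true) ≡ n
count-true {zero}  = refl
count-true {suc n} = cong suc (count-true {n})

count-complement : ∀ {n} (p : Fin n → Bool) → count p + count (λ i → not (p i)) ≡ n
count-complement {n} p = trans (≡-sym (count-split (λ _ → true) p)) (count-true {n})

count-∧ˡ : ∀ {n} b (p : Fin n → Bool) → count (λ i → b ∧ p i) ≡ (if b then count p else 0)
count-∧ˡ true  p = refl
count-∧ˡ {n} false p = count-false {n}

count-point : ∀ {n} (x : Fin n) (p : Fin n → Bool) → count (λ i → p i ∧ (i == x)) ≡ χ (p x)
count-point {n} x p = begin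
  count (λ i → p i ∧ (i == x))                     ≡⟨ count≡sumFin (λ i → p i ∧ (i == x)) ⟩
  sumFin (λ i → χ (p i ∧ (i == x)))                ≡⟨ sumFin-cong (λ i → χ-∧ (p i) (i == x)) ⟩
  sumFin (λ i → if i == x then χ (p i) else 0)     ≡⟨ sumFin-point x (λ i → χ (p i)) ⟩
  χ (p x)                                          ∎
  where
  open ≡-Reasoning
  χ-∧ : ∀ a b → χ (a ∧ b) ≡ (if b then χ a else 0)
  χ-∧ false false = refl
  χ-∧ false true  = refl
  χ-∧ true  false = refl
  χ-∧ true  true  = refl

sumFin-if-not : ∀ {n} (q p : Fin n → Bool) → sumFin (λ i → if q i then 0 else χ (p i)) ≡ count (λ i → p i ∧ not (q i))
sumFin-if-not q p = trans (sumFin-cong (λ i → χ-∧-not (q i) (p i))) (≡-sym (count≡sumFin (λ i → p i ∧ not (q i))))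
  where
  χ-∧-not : ∀ b a → (if b then 0 else χ a) ≡ χ (a ∧ not b)
  χ-∧-not true  a = cong χ (≡-sym (∧-zeroʳ a))
  χ-∧-not false a = cong χ (≡-sym (∧-identityʳ a))

-- The entries with row outside S and column in S are the transposes of those counted
-- by the second summand.
sumFin²-restrict : ∀ {n} (f : Fin n → Fin n → ℕ) → (∀ x w → f x w ≡ f w x) → (S : Fin n → Bool) →
  sumFin (λ x → if S x then sumFin (f x) + sumFin (λ w → if S w then 0 else f x w) else 0)
    ≤ sumFin (λ x → sumFin (f x))
sumFin²-restrict {n} f f-sym S = begin
  sumFin (λ x → if S x then sumFin (f x) + sumFin (λ w → if S w then 0 else f x w) else 0)
    ≡⟨ sumFin-cong split ⟩
  sumFin (λ x → sumFin (inS x) + sumFin (outS x))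
    ≡⟨ sumFin-+ (λ x → sumFin (inS x)) (λ x → sumFin (outS x)) ⟩
  sumFin (λ x → sumFin (inS x)) + sumFin (λ x → sumFin (outS x))
    ≡⟨ cong (sumFin (λ x → sumFin (inS x)) +_)
            (trans (sumFin-swap outS) (sumFin-cong (λ x → sumFin-cong (transpose x)))) ⟩
  sumFin (λ x → sumFin (inS x)) + sumFin (λ x → sumFin (outS′ x))
    ≡⟨ ≡-sym (sumFin-+ (λ x → sumFin (inS x)) (λ x → sumFin (outS′ x))) ⟩
  sumFin (λ x → sumFin (inS x) + sumFin (outS′ x))
    ≤⟨ sumFin-mono (λ x → ≤-trans (≤-reflexive (≡-sym (sumFin-+ (inS x) (outS′ x))))
                                    (sumFin-mono (λ w → disjoint (S x) (S w) (f x w)))) ⟩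
  sumFin (λ x → sumFin (f x)) ∎
  where
  open ≤-Reasoning
  inS outS outS′ : Fin n → Fin n → ℕ
  inS   x w = if S x then f x w else 0
  outS  x w = if S x then (if S w then 0 else f x w) else 0
  outS′ x w = if S w then (if S x then 0 else f x w) else 0
  split : ∀ x → (if S x then sumFin (f x) + sumFin (λ w → if S w then 0 else f x w) else 0)
              ≡ sumFin (inS x) + sumFin (outS x)
  split x with S x
  ... | true  = refl
  ... | false = ≡-sym (cong₂ _+_ (sumFin-zero {n}) (sumFin-zero {n}))
  transpose : ∀ x w → outS w x ≡ outS′ x w
  transpose x w = cong (λ y → if S w then (if S x then 0 else y) else 0) (f-sym w x)
  disjoint : ∀ s t y → (if s then y else 0) + (if t then (if s then 0 else y) else 0) ≤ y
  disjoint true  true  y = ≤-reflexive (+-identityʳ y)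
  disjoint true  false y = ≤-reflexive (+-identityʳ y)
  disjoint false true  y = ≤-refl
  disjoint false false y = z≤n

count-singleton : ∀ {n} (x : Fin n) → count (_== x) ≡ 1
count-singleton x = count-point x (λ _ → true)

count-singletonˡ : ∀ {n} (x : Fin n) → count (x ==_) ≡ 1
count-singletonˡ x = trans (count-cong (==-sym x)) (count-singleton x)

count-++ : ∀ a {b} (p : Fin (a + b) → Bool) → count p ≡ count (λ i → p (i ↑ˡ b)) + count (λ i → p (a ↑ʳ i))
count-++ zero    p = refl
count-++ (suc a) p = trans (cong (χ (p Fin.zero) +_) (count-++ a (λ i → p (Fin.suc i)))) (≡-sym (+-assoc (χ (p Fin.zero)) _ _))

-- Private neighbourhoods

module Neighbourhoods {n : ℕ} (G : Graph n) where

  infix 7 _~_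
  _~_ : Fin n → Fin n → Bool
  _~_ = adj G

  ~⇒toℕ≢ : ∀ {x w} → x ~ w ≡ true → toℕ x ≢ toℕ w
  ~⇒toℕ≢ {x} x~w e with toℕ-injective e
  ... | refl with trans (≡-sym x~w) (irrefl G x)
  ... | ()

  closedNbr : Fin n → Fin n → Bool
  closedNbr x w = (w == x) ∨ (x ~ w)

  common : Fin n → Fin n → ℕ
  common v x = count λ w → v ~ w ∧ x ~ w

  privateDegree : Fin n → Fin n → ℕ
  privateDegree v x = count λ w → v ~ w ∧ not (closedNbr x w)

  privateSum : Fin n → ℕ
  privateSum v = sumFin λ x → if v ~ x then privateDegree v x else 0

  common-sym : ∀ v x → common v x ≡ common x v
  common-sym v x = count-cong (λ w → ∧-comm (v ~ w) (x ~ w))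

  degree-split : ∀ {v x} → v ~ x ≡ true → degree G v ≡ common v x + suc (privateDegree v x)
  degree-split {v} {x} v~x = begin
    count (v ~_)
      ≡⟨ count-split (v ~_) (x ~_) ⟩
    common v x + count (λ w → v ~ w ∧ not (x ~ w))
      ≡⟨ cong (common v x +_) (count-split (λ w → v ~ w ∧ not (x ~ w)) (_== x)) ⟩
    common v x + (count (λ w → (v ~ w ∧ not (x ~ w)) ∧ (w == x)) + count (λ w → (v ~ w ∧ not (x ~ w)) ∧ not (w == x)))
      ≡⟨ cong₂ (λ a b → common v x + (a + b)) (count-point x (λ w → v ~ w ∧ not (x ~ w)))
                                               (count-cong (λ w → ∧-not-∨ (v ~ w) (x ~ w) (w == x))) ⟩
    common v x + (χ (v ~ x ∧ not (x ~ x)) + privateDegree v x)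
      ≡⟨ cong (λ b → common v x + (χ (b ∧ not (x ~ x)) + privateDegree v x)) v~x ⟩
    common v x + (χ (not (x ~ x)) + privateDegree v x)
      ≡⟨ cong (λ b → common v x + (χ (not b) + privateDegree v x)) (irrefl G x) ⟩
    common v x + suc (privateDegree v x) ∎
    where open ≡-Reasoning

  privateDegree-sym : ∀ {v x} → v ~ x ≡ true → degree G v ≡ degree G x → privateDegree v x ≡ privateDegree x v
  privateDegree-sym {v} {x} v~x dv≡dx = suc-injective (+-cancelˡ-≡ (common v x) _ _ (begin
    common v x + suc (privateDegree v x) ≡⟨ ≡-sym (degree-split v~x) ⟩
    degree G v                           ≡⟨ dv≡dx ⟩
    degree G x                           ≡⟨ degree-split (trans (sym G x v) v~x) ⟩
    common x v + suc (privateDegree x v) ≡⟨ cong (_+ suc (privateDegree x v)) (common-sym x v) ⟩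
    common v x + suc (privateDegree x v) ∎))
    where open ≡-Reasoning

  triangle : Fin n → Fin n → Fin n → Bool
  triangle v x w = v ~ x ∧ v ~ w ∧ x ~ w

  sumFin-triangle≡2*K3degree : ∀ v → sumFin (λ x → count (triangle v x)) ≡ 2 * K3degree G v
  sumFin-triangle≡2*K3degree v = begin
    sumFin (λ x → count (triangle v x))
      ≡⟨ sumFin-cong (λ x → trans (count≡sumFin (triangle v x)) (sumFin-cong (split x))) ⟩
    sumFin (λ x → sumFin (λ w → χ (ordered x w) + χ (ordered w x)))
      ≡⟨ sumFin-cong (λ x → sumFin-+ (λ w → χ (ordered x w)) (λ w → χ (ordered w x))) ⟩
    sumFin (λ x → sumFin (λ w → χ (ordered x w)) + sumFin (λ w → χ (ordered w x)))
      ≡⟨ sumFin-+ (λ x → sumFin (λ w → χ (ordered x w))) (λ x → sumFin (λ w → χ (ordered w x))) ⟩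
    sumFin (λ x → sumFin (λ w → χ (ordered x w))) + sumFin (λ x → sumFin (λ w → χ (ordered w x)))
      ≡⟨ cong (K3 +_) (sumFin-swap (λ x w → χ (ordered w x))) ⟩
    K3 + K3
      ≡⟨ cong (K3 +_) (≡-sym (+-identityʳ K3)) ⟩
    2 * K3
      ≡⟨ cong (2 *_) (sumFin-cong (λ x → ≡-sym (count≡sumFin (ordered x)))) ⟩
    2 * K3degree G v ∎
    where
    open ≡-Reasoning
    ordered : Fin n → Fin n → Bool
    ordered x w = v ~ x ∧ v ~ w ∧ x ~ w ∧ (toℕ x <ᵇ toℕ w)
    K3 : ℕ
    K3 = sumFin (λ x → sumFin (λ w → χ (ordered x w)))
    split : ∀ x w → χ (triangle v x w) ≡ χ (ordered x w) + χ (ordered w x)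
    split x w = trans (χ-split-ordered (v ~ x) (v ~ w) (x ~ w) _ _ (λ x~w → <ᵇ-flip _ _ (~⇒toℕ≢ x~w)))
                      (cong (λ c → χ (ordered x w) + χ (v ~ w ∧ v ~ x ∧ c ∧ (toℕ w <ᵇ toℕ x))) (sym G x w))

  sumFin-triangle+privateSum : ∀ v → sumFin (λ x → count (triangle v x)) + privateSum v ≡ degree G v * (degree G v ∸ 1)
  sumFin-triangle+privateSum v = begin
    sumFin (λ x → count (triangle v x)) + privateSum v
      ≡⟨ ≡-sym (sumFin-+ (λ x → count (triangle v x)) (λ x → if v ~ x then privateDegree v x else 0)) ⟩
    sumFin (λ x → count (triangle v x) + (if v ~ x then privateDegree v x else 0))
      ≡⟨ sumFin-cong row ⟩
    sumFin (λ x → if v ~ x then degree G v ∸ 1 else 0)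
      ≡⟨ sumFin-if (v ~_) (degree G v ∸ 1) ⟩
    degree G v * (degree G v ∸ 1) ∎
    where
    open ≡-Reasoning
    row : ∀ x → count (triangle v x) + (if v ~ x then privateDegree v x else 0) ≡ (if v ~ x then degree G v ∸ 1 else 0)
    row x rewrite count-∧ˡ (v ~ x) (λ w → v ~ w ∧ x ~ w) with v ~ x in v~x
    ... | true  = ≡-sym (cong (_∸ 1) (trans (degree-split v~x) (+-suc (common v x) (privateDegree v x))))
    ... | false = refl

  K3degree-privateSum : ∀ v → 2 * K3degree G v + privateSum v ≡ degree G v * (degree G v ∸ 1)
  K3degree-privateSum v =
    trans (cong (_+ privateSum v) (≡-sym (sumFin-triangle≡2*K3degree v))) (sumFin-triangle+privateSum v)

  privateDegree₂ : Fin n → Fin n → Fin n → ℕ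
  privateDegree₂ v x u = count λ w → (v ~ w ∧ not (closedNbr x w)) ∧ not (closedNbr u w)

  nonEdge : Fin n → Fin n → Fin n → Bool
  nonEdge v x w = v ~ x ∧ v ~ w ∧ not (closedNbr x w)

  nonEdge-sym : ∀ v x w → nonEdge v x w ≡ nonEdge v w x
  nonEdge-sym v x w rewrite ==-sym w x | sym G x w = ∧-swap (v ~ x) (v ~ w) _
    where
    ∧-swap : ∀ a b c → a ∧ b ∧ c ≡ b ∧ a ∧ c
    ∧-swap false false c = refl
    ∧-swap false true  c = refl
    ∧-swap true  false c = refl
    ∧-swap true  true  c = refl

  privateSum≡sumFin-nonEdge : ∀ v → privateSum v ≡ sumFin (λ x → sumFin (λ w → χ (nonEdge v x w)))
  privateSum≡sumFin-nonEdge v = sumFin-cong λ x →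
    trans (≡-sym (count-∧ˡ (v ~ x) (λ w → v ~ w ∧ not (closedNbr x w)))) (count≡sumFin (nonEdge v x))

  nonEdge-row : ∀ v x u →
    sumFin (λ w → χ (nonEdge v x w)) + sumFin (λ w → if closedNbr u w then 0 else χ (nonEdge v x w))
      ≡ (if v ~ x then privateDegree v x + privateDegree₂ v x u else 0)
  nonEdge-row v x u = begin
    sumFin (λ w → χ (nonEdge v x w)) + sumFin (λ w → if closedNbr u w then 0 else χ (nonEdge v x w))
      ≡⟨ cong₂ _+_ (≡-sym (count≡sumFin (nonEdge v x))) (sumFin-if-not (closedNbr u) (nonEdge v x)) ⟩
    count (nonEdge v x) + count (λ w → nonEdge v x w ∧ not (closedNbr u w))
      ≡⟨ cong₂ _+_ (count-∧ˡ (v ~ x) (λ w → v ~ w ∧ not (closedNbr x w)))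
                   (trans (count-cong (λ w → ∧-assoc (v ~ x) (v ~ w ∧ not (closedNbr x w)) (not (closedNbr u w))))
                          (count-∧ˡ (v ~ x) (λ w → (v ~ w ∧ not (closedNbr x w)) ∧ not (closedNbr u w)))) ⟩
    (if v ~ x then privateDegree v x else 0) + (if v ~ x then privateDegree₂ v x u else 0)
      ≡⟨ if-+ (v ~ x) ⟩
    (if v ~ x then privateDegree v x + privateDegree₂ v x u else 0) ∎
    where
    open ≡-Reasoning
    if-+ : ∀ b {y z} → (if b then y else 0) + (if b then z else 0) ≡ (if b then y + z else 0)
    if-+ true  = refl
    if-+ false = refl

  privateDegree₂-self : ∀ v u → privateDegree₂ v u u ≡ privateDegree v u
  privateDegree₂-self v u = count-cong (λ w → ∧-not-idem (v ~ w) (closedNbr u w))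
    where
    ∧-not-idem : ∀ a b → (a ∧ not b) ∧ not b ≡ a ∧ not b
    ∧-not-idem false b     = refl
    ∧-not-idem true  false = refl
    ∧-not-idem true  true  = refl

  sumFin-closedNbr : ∀ u (h : Fin n → ℕ) →
    sumFin (λ x → if closedNbr u x then h x else 0) ≡ h u + sumFin (λ x → if u ~ x then h x else 0)
  sumFin-closedNbr u h =
    trans (sumFin-cong split)
          (trans (sumFin-+ (λ x → if x == u then h x else 0) (λ x → if u ~ x then h x else 0))
                 (cong (_+ sumFin (λ x → if u ~ x then h x else 0)) (sumFin-point u h)))
    where
    split : ∀ x → (if closedNbr u x then h x else 0) ≡ (if x == u then h x else 0) + (if u ~ x then h x else 0)
    split x with x == u in x=u
    ... | false = refl
    ... | true with ==⇒≡ {i = x} {u} x=u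
    ... | refl rewrite irrefl G u = ≡-sym (+-identityʳ (h u))

  privateSum-lower : ∀ {v u} → v ~ u ≡ true →
    2 * privateDegree v u + sumFin (λ x → if u ~ x ∧ v ~ x then privateDegree v x + privateDegree₂ v x u else 0)
      ≤ privateSum v
  privateSum-lower {v} {u} v~u = begin
    2 * privateDegree v u + sumFin (λ x → if u ~ x ∧ v ~ x then privateDegree v x + privateDegree₂ v x u else 0)
      ≡⟨ cong₂ _+_ twice (sumFin-cong (λ x → if-∧ (u ~ x) (v ~ x))) ⟩
    h u + sumFin (λ x → if u ~ x then h x else 0)
      ≡⟨ ≡-sym (sumFin-closedNbr u h) ⟩
    sumFin (λ x → if closedNbr u x then h x else 0)
      ≡⟨ sumFin-cong (λ x → cong (λ y → if closedNbr u x then y else 0) (≡-sym (nonEdge-row v x u))) ⟩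
    sumFin (λ x → if closedNbr u x then sumFin (f x) + sumFin (λ w → if closedNbr u w then 0 else f x w) else 0)
      ≤⟨ sumFin²-restrict f (λ x w → cong χ (nonEdge-sym v x w)) (closedNbr u) ⟩
    sumFin (λ x → sumFin (f x))
      ≡⟨ ≡-sym (privateSum≡sumFin-nonEdge v) ⟩
    privateSum v ∎
    where
    open ≤-Reasoning
    f : Fin n → Fin n → ℕ
    f x w = χ (nonEdge v x w)
    h : Fin n → ℕ
    h x = if v ~ x then privateDegree v x + privateDegree₂ v x u else 0
    twice : 2 * privateDegree v u ≡ h u
    twice rewrite v~u | privateDegree₂-self v u = cong (privateDegree v u +_) (+-identityʳ _)
    if-∧ : ∀ a b {y} → (if a ∧ b then y else 0) ≡ (if a then (if b then y else 0) else 0)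
    if-∧ true  b = refl
    if-∧ false b = refl

  privateSum-≤ : ∀ {v c} → (∀ x → v ~ x ≡ true → privateDegree v x ≤ c) → privateSum v ≤ degree G v * c
  privateSum-≤ {v} {c} bound = ≤-trans (sumFin-mono term) (≤-reflexive (sumFin-if (v ~_) c))
    where
    term : ∀ x → (if v ~ x then privateDegree v x else 0) ≤ (if v ~ x then c else 0)
    term x with v ~ x in v~x
    ... | true  = bound x v~x
    ... | false = z≤n

  privateSum-≡ : ∀ {v c} → (∀ x → v ~ x ≡ true → privateDegree v x ≡ c) → privateSum v ≡ degree G v * c
  privateSum-≡ {v} {c} value = trans (sumFin-cong term) (sumFin-if (v ~_) c)
    where
    term : ∀ x → (if v ~ x then privateDegree v x else 0) ≡ (if v ~ x then c else 0)
    term x with v ~ x in v~x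
    ... | true  = value x v~x
    ... | false = refl

module Regular {n : ℕ} (G : Graph n) {d : ℕ} (regular : ∀ v → degree G v ≡ d) where
  open Neighbourhoods G

  privateDegree-transfer : ∀ {v x} u → v ~ x ≡ true → privateDegree u v ≤ privateDegree v x + privateDegree₂ u x v
  privateDegree-transfer {v} {x} u v~x = begin
    privateDegree u v
      ≡⟨ count-split (λ w → u ~ w ∧ not (closedNbr v w)) (x ~_) ⟩
    count (λ w → (u ~ w ∧ not (closedNbr v w)) ∧ x ~ w) + count (λ w → (u ~ w ∧ not (closedNbr v w)) ∧ not (x ~ w))
      ≤⟨ +-mono-≤ (count-mono (λ w → into-N[x] (u ~ w) (closedNbr v w) (x ~ w)))
                  (count-mono (λ w → outside-N[x] (u ~ w) (closedNbr v w) (w == x) (x ~ w) (x∈N[v] w))) ⟩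
    privateDegree x v + privateDegree₂ u x v
      ≡⟨ cong (_+ privateDegree₂ u x v) (privateDegree-sym (trans (sym G x v) v~x) (trans (regular x) (≡-sym (regular v)))) ⟩
    privateDegree v x + privateDegree₂ u x v ∎
    where
    open ≤-Reasoning
    x∈N[v] : ∀ w → w == x ≡ true → closedNbr v w ≡ true
    x∈N[v] w w=x with ==⇒≡ {i = w} {x} w=x
    ... | refl = trans (cong (w == v ∨_) v~x) (∨-zeroʳ (w == v))
    into-N[x] : ∀ a b c → (a ∧ not b) ∧ c ≡ true → c ∧ not b ≡ true
    into-N[x] true false true _ = refl
    outside-N[x] : ∀ a b e c → (e ≡ true → b ≡ true) →
      (a ∧ not b) ∧ not c ≡ true → (a ∧ not (e ∨ c)) ∧ not b ≡ true
    outside-N[x] true false false false _ _ = refl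
    outside-N[x] true false true  false h _ with h refl
    ... | ()

  privateDegree-regular-sym : ∀ {v u} → v ~ u ≡ true → privateDegree v u ≡ privateDegree u v
  privateDegree-regular-sym {v} {u} v~u = privateDegree-sym v~u (trans (regular v) (≡-sym (regular u)))

  common-neighbour-bound : ∀ {v u x} → v ~ u ≡ true → v ~ x ≡ true → u ~ x ≡ true →
    privateDegree v u + privateDegree v u
      ≤ (privateDegree v x + privateDegree₂ v x u) + (privateDegree u x + privateDegree₂ u x v)
  common-neighbour-bound {v} {u} {x} v~u v~x u~x = begin
    privateDegree v u + privateDegree v u
      ≡⟨ cong (privateDegree v u +_) (privateDegree-regular-sym v~u) ⟩
    privateDegree v u + privateDegree u v
      ≤⟨ +-mono-≤ (privateDegree-transfer v u~x) (privateDegree-transfer u v~x) ⟩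
    (privateDegree u x + privateDegree₂ v x u) + (privateDegree v x + privateDegree₂ u x v)
      ≡⟨ swap (privateDegree u x) (privateDegree₂ v x u) (privateDegree v x) (privateDegree₂ u x v) ⟩
    (privateDegree v x + privateDegree₂ v x u) + (privateDegree u x + privateDegree₂ u x v) ∎
    where
    open ≤-Reasoning
    swap : ∀ p q r s → (p + q) + (r + s) ≡ (r + q) + (p + s)
    swap = solve-∀

  -- The a non-edges at u in the link of v count twice in privateSum v (likewise at v in
  -- the link of u), and each common neighbour of v and u meets 2a further non-edges.
  privateSum-edge : ∀ {v u} → v ~ u ≡ true →
    2 * ((2 + common v u) * privateDegree v u) ≤ privateSum v + privateSum u
  privateSum-edge {v} {u} v~u = begin
    2 * ((2 + common v u) * a)
      ≡⟨ expand (common v u) a ⟩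
    (2 * a + 2 * a) + common v u * (a + a)
      ≡⟨ cong ((2 * a + 2 * a) +_) (≡-sym (sumFin-if (λ x → v ~ x ∧ u ~ x) (a + a))) ⟩
    (2 * a + 2 * a) + sumFin (λ x → if v ~ x ∧ u ~ x then a + a else 0)
      ≤⟨ +-monoʳ-≤ (2 * a + 2 * a) (≤-trans (sumFin-mono per-common-neighbour) (≤-reflexive (sumFin-+ Σv Σu))) ⟩
    (2 * a + 2 * a) + (sumFin Σv + sumFin Σu)
      ≡⟨ interchange (2 * a) (2 * a) (sumFin Σv) (sumFin Σu) ⟩
    (2 * a + sumFin Σv) + (2 * a + sumFin Σu)
      ≤⟨ +-mono-≤ (privateSum-lower v~u) (subst (λ b → 2 * b + sumFin Σu ≤ privateSum u) a≡ (privateSum-lower u~v)) ⟩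
    privateSum v + privateSum u ∎
    where
    open ≤-Reasoning
    a : ℕ
    a = privateDegree v u
    u~v : u ~ v ≡ true
    u~v = trans (sym G u v) v~u
    a≡ : privateDegree u v ≡ a
    a≡ = ≡-sym (privateDegree-regular-sym v~u)
    Σv Σu : Fin n → ℕ
    Σv x = if u ~ x ∧ v ~ x then privateDegree v x + privateDegree₂ v x u else 0
    Σu x = if v ~ x ∧ u ~ x then privateDegree u x + privateDegree₂ u x v else 0
    expand : ∀ c a → 2 * ((2 + c) * a) ≡ (2 * a + 2 * a) + c * (a + a)
    expand = solve-∀
    per-common-neighbour : ∀ x → (if v ~ x ∧ u ~ x then a + a else 0) ≤ Σv x + Σu x
    per-common-neighbour x with v ~ x in v~x | u ~ x in u~x
    ... | false | _     = z≤n
    ... | true  | false = z≤n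
    ... | true  | true  = common-neighbour-bound v~u v~x u~x

  privateSum-bound : ∀ {v u} → v ~ u ≡ true → privateSum u ≡ privateSum v →
    (2 + common v u) * privateDegree v u ≤ privateSum v
  privateSum-bound {v} {u} v~u same = *-cancelˡ-≤ 2 (begin
    2 * ((2 + common v u) * privateDegree v u) ≤⟨ privateSum-edge v~u ⟩
    privateSum v + privateSum u                ≡⟨ cong (privateSum v +_) (trans same (≡-sym (+-identityʳ _))) ⟩
    2 * privateSum v                           ∎)
    where open ≤-Reasoning

  degree-edge : ∀ {v x} → v ~ x ≡ true → d ≡ common v x + suc (privateDegree v x)
  degree-edge {v} v~x = trans (≡-sym (regular v)) (degree-split v~x)

  privateSum-of-privateDegree≡1 : ∀ {v x} → v ~ x ≡ true → privateDegree v x ≡ 1 → privateSum x ≡ privateSum v →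
    (∀ y → v ~ y ≡ true → privateDegree v y ≤ 1) → privateSum v ≡ d
  privateSum-of-privateDegree≡1 {v} {x} v~x a≡1 same bound = ≤-antisym upper lower
    where
    upper : privateSum v ≤ d
    upper = ≤-trans (privateSum-≤ bound) (≤-reflexive (trans (*-identityʳ _) (regular v)))
    lower : d ≤ privateSum v
    lower = begin
      d                                            ≡⟨ degree-edge v~x ⟩
      common v x + suc (privateDegree v x)         ≡⟨ cong (λ a → common v x + suc a) a≡1 ⟩
      common v x + 2                               ≡⟨ shift (common v x) ⟩
      (2 + common v x) * 1                         ≡⟨ cong ((2 + common v x) *_) (≡-sym a≡1) ⟩
      (2 + common v x) * privateDegree v x         ≤⟨ privateSum-bound v~x same ⟩
      privateSum v                                 ∎
      where
      open ≤-Reasoning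
      shift : ∀ c → c + 2 ≡ (2 + c) * 1
      shift = solve-∀

  privateSum-of-privateDegree≥2 : ∀ {v x} → v ~ x ≡ true → 2 ≤ privateDegree v x → privateSum x ≡ privateSum v →
    2 * (d ∸ 1) ≤ privateSum v
  privateSum-of-privateDegree≥2 {v} {x} v~x 2≤a same = begin
    2 * (d ∸ 1)                                  ≡⟨ cong (λ m → 2 * (m ∸ 1)) (trans (degree-edge v~x) (+-suc (common v x) _)) ⟩
    2 * (common v x + privateDegree v x)         ≤⟨ double≤ (common v x) 2≤a ⟩
    (2 + common v x) * privateDegree v x         ≤⟨ privateSum-bound v~x same ⟩
    privateSum v                                 ∎
    where
    open ≤-Reasoning
    double≤ : ∀ c {a} → 2 ≤ a → 2 * (c + a) ≤ (2 + c) * a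
    double≤ c {suc zero}    (s≤s ())
    double≤ c {suc (suc b)} _ = ≤-trans (m≤m+n _ (c * b)) (≤-reflexive (expand c b))
      where
      expand : ∀ c b → 2 * (c + suc (suc b)) + c * b ≡ (2 + c) * suc (suc b)
      expand = solve-∀

  private
    counterexample-neighbour : ∀ {v x} {P : Set} → ¬ (v ~ x ≡ true → P) → v ~ x ≡ true × ¬ P
    counterexample-neighbour {v} {x} ¬imp with v ~ x
    ... | true  = refl , λ p → ¬imp (λ _ → p)
    ... | false = ⊥-elim (¬imp (λ ()))

    find-counterexample-neighbour : ∀ v {P : Fin n → Set} → (∀ x → Dec (P x)) → ¬ (∀ x → v ~ x ≡ true → P x) →
      Σ (Fin n) λ x → v ~ x ≡ true × ¬ P x
    find-counterexample-neighbour v P? ¬all with ¬∀⟶∃¬ n _ (λ x → (v ~ x ≟ᵇ true) →-dec P? x) ¬all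
    ... | x , ¬imp = x , counterexample-neighbour ¬imp

  privateSum-trichotomy : (∀ v w → privateSum v ≡ privateSum w) → ∀ v →
    privateSum v ≡ 0 ⊎ privateSum v ≡ d ⊎ 2 * (d ∸ 1) ≤ privateSum v
  privateSum-trichotomy balanced v
    with all? (λ x → (v ~ x ≟ᵇ true) →-dec (privateDegree v x ≤? 1))
  ... | no ¬≤1 with find-counterexample-neighbour v (λ x → privateDegree v x ≤? 1) ¬≤1
  ...   | x , v~x , a≰1 = inj₂ (inj₂ (privateSum-of-privateDegree≥2 v~x (≰⇒> a≰1) (balanced x v)))
  privateSum-trichotomy balanced v | yes ≤1
    with all? (λ x → (v ~ x ≟ᵇ true) →-dec (privateDegree v x ≟ 0))
  ... | yes ≡0 = inj₁ (trans (privateSum-≡ ≡0) (*-zeroʳ (degree G v)))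
  ... | no ¬≡0 with find-counterexample-neighbour v (λ x → privateDegree v x ≟ 0) ¬≡0
  ...   | x , v~x , a≢0 =
    inj₂ (inj₁ (privateSum-of-privateDegree≡1 v~x (≤-antisym (≤1 x v~x) (n≢0⇒n>0 a≢0)) (balanced x v) ≤1))

-- Binomial arithmetic

C2-suc : ∀ m → suc m C 2 ≡ m C 2 + m
C2-suc m = trans (≡-sym (nCk+nC[k+1]≡[n+1]C[k+1] m 1)) (trans (cong (_+ m C 2) (nC1≡n m)) (+-comm m (m C 2)))

*-pred-suc : ∀ m → m * (m ∸ 1) + 2 * m ≡ suc m * m
*-pred-suc zero    = refl
*-pred-suc (suc m) = expand m
  where
  expand : ∀ m → suc m * m + 2 * suc m ≡ suc (suc m) * suc m
  expand = solve-∀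

2*C2 : ∀ m → 2 * (m C 2) ≡ m * (m ∸ 1)
2*C2 zero    = refl
2*C2 (suc m) = begin
  2 * (suc m C 2)           ≡⟨ cong (2 *_) (C2-suc m) ⟩
  2 * (m C 2 + m)           ≡⟨ *-distribˡ-+ 2 (m C 2) m ⟩
  2 * (m C 2) + 2 * m       ≡⟨ cong (_+ 2 * m) (2*C2 m) ⟩
  m * (m ∸ 1) + 2 * m       ≡⟨ *-pred-suc m ⟩
  suc m * m                 ∎
  where open ≡-Reasoning

*-pred≡2*C2+2*pred : ∀ d → d * (d ∸ 1) ≡ 2 * ((d ∸ 1) C 2) + 2 * (d ∸ 1)
*-pred≡2*C2+2*pred zero    = refl
*-pred≡2*C2+2*pred (suc m) = trans (≡-sym (*-pred-suc m)) (cong (_+ 2 * m) (≡-sym (2*C2 m)))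

double-C2 : ∀ k → (2 * k) C 2 ≡ 4 * (k C 2) + k
double-C2 k = *-cancelˡ-≡ _ _ 2 (begin
  2 * ((2 * k) C 2)               ≡⟨ 2*C2 (2 * k) ⟩
  2 * k * (2 * k ∸ 1)             ≡⟨ lemma k ⟩
  4 * (k * (k ∸ 1)) + 2 * k       ≡⟨ cong (λ t → 4 * t + 2 * k) (≡-sym (2*C2 k)) ⟩
  4 * (2 * (k C 2)) + 2 * k       ≡⟨ regroup (k C 2) k ⟩
  2 * (4 * (k C 2) + k)           ∎)
  where
  open ≡-Reasoning
  lemma : ∀ k → 2 * k * (2 * k ∸ 1) ≡ 4 * (k * (k ∸ 1)) + 2 * k
  lemma zero    = refl
  lemma (suc j) = expand j
    where
    expand : ∀ j → 2 * suc j * (j + suc (j + 0)) ≡ 4 * (suc j * j) + 2 * suc j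
    expand = solve-∀
  regroup : ∀ c k → 4 * (2 * c) + 2 * k ≡ 2 * (4 * c + k)
  regroup = solve-∀

4*C2≤double-C2 : ∀ k → 4 * (k C 2) ≤ (2 * k) C 2
4*C2≤double-C2 k = ≤-trans (m≤m+n (4 * (k C 2)) k) (≤-reflexive (≡-sym (double-C2 k)))

pred-double-C2≤4*C2 : ∀ k → (2 * k ∸ 1) C 2 ≤ 4 * (k C 2)
pred-double-C2≤4*C2 zero    = z≤n
pred-double-C2≤4*C2 (suc j) = +-cancelʳ-≤ (suc j) _ _ (begin
  m C 2 + suc j         ≤⟨ +-monoʳ-≤ (m C 2) (≤-trans (m≤n+m (suc j) j) (≤-reflexive (cong (_∸ 1) (double j)))) ⟩
  m C 2 + m             ≡⟨ ≡-sym (C2-suc m) ⟩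
  (2 * suc j) C 2       ≡⟨ double-C2 (suc j) ⟩
  4 * (suc j C 2) + suc j ∎)
  where
  open ≤-Reasoning
  m : ℕ
  m = 2 * suc j ∸ 1
  double : ∀ j → suc (j + suc j) ≡ 2 * suc j
  double = solve-∀

-- The three possible K3-degrees

HasParams-privateSum : ∀ {n d r} (G : Graph n) → HasParams G d r → ∀ v → 2 * r + Neighbourhoods.privateSum G v ≡ d * (d ∸ 1)
HasParams-privateSum G params v =
  subst₂ (λ t e → 2 * t + privateSum v ≡ e * (e ∸ 1)) (proj₂ (params v)) (proj₁ (params v)) (K3degree-privateSum v)
  where open Neighbourhoods G

trichotomy-from-privateSum : ∀ {d r M} → 2 * r + M ≡ d * (d ∸ 1) → M ≡ 0 ⊎ M ≡ d ⊎ 2 * (d ∸ 1) ≤ M →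
  r ≡ d C 2 ⊎ 2 * r + d ≡ d * (d ∸ 1) ⊎ r ≤ (d ∸ 1) C 2
trichotomy-from-privateSum {d} {r} identity (inj₁ refl) =
  inj₁ (*-cancelˡ-≡ r (d C 2) 2 (trans (≡-sym (+-identityʳ (2 * r))) (trans identity (≡-sym (2*C2 d)))))
trichotomy-from-privateSum identity (inj₂ (inj₁ refl)) = inj₂ (inj₁ identity)
trichotomy-from-privateSum {d} {r} {M} identity (inj₂ (inj₂ 2[d-1]≤M)) =
  inj₂ (inj₂ (*-cancelˡ-≤ 2 (+-cancelʳ-≤ (2 * (d ∸ 1)) _ _ (begin
  2 * r + 2 * (d ∸ 1)             ≤⟨ +-monoʳ-≤ (2 * r) 2[d-1]≤M ⟩
  2 * r + M                       ≡⟨ identity ⟩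
  d * (d ∸ 1)                     ≡⟨ *-pred≡2*C2+2*pred d ⟩
  2 * ((d ∸ 1) C 2) + 2 * (d ∸ 1) ∎))))
  where open ≤-Reasoning

HasParams-trichotomy : ∀ {n d r} (G : Graph (suc n)) → HasParams G d r →
  r ≡ d C 2 ⊎ 2 * r + d ≡ d * (d ∸ 1) ⊎ r ≤ (d ∸ 1) C 2
HasParams-trichotomy {d = d} {r} G params =
  trichotomy-from-privateSum (identity Fin.zero) (privateSum-trichotomy balanced Fin.zero)
  where
  open Neighbourhoods G
  open Regular G (λ v → proj₁ (params v))
  identity : ∀ v → 2 * r + privateSum v ≡ d * (d ∸ 1)
  identity = HasParams-privateSum G params
  balanced : ∀ v w → privateSum v ≡ privateSum w
  balanced v w = +-cancelˡ-≡ (2 * r) _ _ (trans (identity v) (≡-sym (identity w)))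

even-degree-trichotomy : ∀ {n k r} (G : Graph (suc n)) → HasParams G (2 * k) r →
  r ≡ (2 * k) C 2 ⊎ r ≡ 4 * (k C 2) ⊎ r ≤ (2 * k ∸ 1) C 2
even-degree-trichotomy {k = k} {r} G params with HasParams-trichotomy G params
... | inj₁ r≡         = inj₁ r≡
... | inj₂ (inj₂ r≤)  = inj₂ (inj₂ r≤)
... | inj₂ (inj₁ eq)  = inj₂ (inj₁ (*-cancelˡ-≡ _ _ 2 (+-cancelʳ-≡ (2 * k) _ _ (begin
  2 * r + 2 * k               ≡⟨ eq ⟩
  2 * k * (2 * k ∸ 1)         ≡⟨ ≡-sym (2*C2 (2 * k)) ⟩
  2 * ((2 * k) C 2)           ≡⟨ cong (2 *_) (double-C2 k) ⟩
  2 * (4 * (k C 2) + k)       ≡⟨ *-distribˡ-+ 2 (4 * (k C 2)) k ⟩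
  2 * (4 * (k C 2)) + 2 * k   ∎))))
  where open ≡-Reasoning

-- The extremal graphs

HasParams-of-privateSum : ∀ {n d r M} (G : Graph n) → (∀ v → degree G v ≡ d) →
  (∀ v → Neighbourhoods.privateSum G v ≡ M) → 2 * r + M ≡ d * (d ∸ 1) → HasParams G d r
HasParams-of-privateSum {d = d} {r} {M} G regular constant identity v = regular v , *-cancelˡ-≡ _ _ 2 (+-cancelʳ-≡ M _ _ (begin
  2 * K3degree G v + M             ≡⟨ cong (2 * K3degree G v +_) (≡-sym (constant v)) ⟩
  2 * K3degree G v + privateSum v  ≡⟨ K3degree-privateSum v ⟩
  degree G v * (degree G v ∸ 1)    ≡⟨ cong (λ m → m * (m ∸ 1)) (regular v) ⟩
  d * (d ∸ 1)                      ≡⟨ ≡-sym identity ⟩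
  2 * r + M                        ∎))
  where
  open ≡-Reasoning
  open Neighbourhoods G

degree-K : ∀ N v → degree (K N) v ≡ N ∸ 1
degree-K N v = cong (_∸ 1) (trans (cong (_+ degree (K N) v) (≡-sym (count-singletonˡ v))) (count-complement (v ==_)))

privateDegree-K : ∀ N v x → Neighbourhoods.privateDegree (K N) v x ≡ 0
privateDegree-K N v x = trans (count-cong (λ w → absurd (not (v == w)) (w == x) (x == w) (==-sym w x))) (count-false {N})
  where
  absurd : ∀ a b c → b ≡ c → a ∧ not (b ∨ not c) ≡ false
  absurd false b     c     _    = refl
  absurd true  false false refl = refl
  absurd true  true  true  refl = refl

K-params : ∀ N → HasParams (K N) (N ∸ 1) ((N ∸ 1) C 2)
K-params N = HasParams-of-privateSum (K N) (degree-K N)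
  (λ v → trans (Neighbourhoods.privateSum-≡ (K N) {v} (λ x _ → privateDegree-K N v x)) (*-zeroʳ (degree (K N) v)))
  (trans (+-identityʳ _) (2*C2 (N ∸ 1)))

count-toℕ-singleton : ∀ {m} c → c < m → count {m} (λ i → c ≡ᵇ toℕ i) ≡ 1
count-toℕ-singleton {suc m} zero    _       = cong suc (count-false {m})
count-toℕ-singleton {suc m} (suc c) (s≤s h) = count-toℕ-singleton c h

residue-class-size : ∀ m {N} → N ≡ suc m + suc m → ∀ c → c < suc m → count {N} (λ w → c ≡ᵇ toℕ w % suc m) ≡ 2
residue-class-size m refl c c<m = begin
  count {suc m + suc m} (λ w → c ≡ᵇ toℕ w % suc m)
    ≡⟨ count-++ (suc m) (λ w → c ≡ᵇ toℕ w % suc m) ⟩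
  count {suc m} (λ i → c ≡ᵇ toℕ (i ↑ˡ suc m) % suc m) + count {suc m} (λ i → c ≡ᵇ toℕ (suc m ↑ʳ i) % suc m)
    ≡⟨ cong₂ _+_ (count-cong (λ i → cong (c ≡ᵇ_) (low i))) (count-cong (λ i → cong (c ≡ᵇ_) (high i))) ⟩
  count {suc m} (λ i → c ≡ᵇ toℕ i) + count {suc m} (λ i → c ≡ᵇ toℕ i)
    ≡⟨ cong₂ _+_ (count-toℕ-singleton c c<m) (count-toℕ-singleton c c<m) ⟩
  2 ∎
  where
  open ≡-Reasoning
  low : ∀ (i : Fin (suc m)) → toℕ (i ↑ˡ suc m) % suc m ≡ toℕ i
  low i = trans (cong (_% suc m) (toℕ-↑ˡ i (suc m))) (m<n⇒m%n≡m (toℕ<n i))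
  high : ∀ (i : Fin (suc m)) → toℕ (suc m ↑ʳ i) % suc m ≡ toℕ i
  high i = begin
    toℕ (suc m ↑ʳ i) % suc m ≡⟨ cong (_% suc m) (trans (toℕ-↑ʳ (suc m) i) (+-comm (suc m) (toℕ i))) ⟩
    (toℕ i + suc m) % suc m  ≡⟨ [m+n]%n≡m%n (toℕ i) (suc m) ⟩
    toℕ i % suc m            ≡⟨ m<n⇒m%n≡m (toℕ<n i) ⟩
    toℕ i                    ∎

module CocktailParty (m : ℕ) {N : ℕ} (N≡ : N ≡ suc m + suc m) where

  CP : Graph N
  CP = Turan N (suc m)
  open Neighbourhoods CP

  part : Fin N → ℕ
  part w = toℕ w % suc m

  part-size : ∀ x → count (λ w → part x ≡ᵇ part w) ≡ 2
  part-size x = residue-class-size m N≡ (part x) (m%n<n (toℕ x) (suc m))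

  degree-CP : ∀ v → degree CP v ≡ N ∸ 2
  degree-CP v = cong (_∸ 2) (trans (cong (_+ degree CP v) (≡-sym (part-size v))) (count-complement (λ w → part v ≡ᵇ part w)))

  -- the private neighbour of v with respect to x is the partner of x in its part
  privateDegree-CP : ∀ {v x} → v ~ x ≡ true → privateDegree v x ≡ 1
  privateDegree-CP {v} {x} v~x = suc-injective (≡-sym (begin
    2
      ≡⟨ ≡-sym (part-size x) ⟩
    count same
      ≡⟨ count-split same (_== x) ⟩
    count (λ w → same w ∧ w == x) + count (λ w → same w ∧ not (w == x))
      ≡⟨ cong₂ _+_ (count-point x same) (count-cong (≡-sym ∘ pointwise)) ⟩
    χ (same x) + privateDegree v x
      ≡⟨ cong (λ b → χ b + privateDegree v x) (≡ᵇ-refl (part x)) ⟩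
    suc (privateDegree v x) ∎))
    where
    open ≡-Reasoning
    same : Fin N → Bool
    same w = part x ≡ᵇ part w
    pointwise : ∀ w → (v ~ w ∧ not (closedNbr x w)) ≡ (same w ∧ not (w == x))
    pointwise w with part x ≡ᵇ part w in e
    ... | false = ∧-not-∨-true (v ~ w) (w == x)
      where
      ∧-not-∨-true : ∀ a b → a ∧ not (b ∨ true) ≡ false
      ∧-not-∨-true false b     = refl
      ∧-not-∨-true true  false = refl
      ∧-not-∨-true true  true  = refl
    ... | true = subst (λ p → not (part v ≡ᵇ p) ∧ not ((w == x) ∨ false) ≡ not (w == x)) (≡ᵇ⇒≡′ e)
                       (∧-not-∨-false (part v ≡ᵇ part x) (w == x) v~x)
      where
      ∧-not-∨-false : ∀ a b → not a ≡ true → not a ∧ not (b ∨ false) ≡ not b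
      ∧-not-∨-false false false _ = refl
      ∧-not-∨-false false true  _ = refl

  privateSum-CP : ∀ v → privateSum v ≡ N ∸ 2
  privateSum-CP v =
    trans (privateSum-≡ {v} (λ x → privateDegree-CP {v} {x})) (trans (*-identityʳ (degree CP v)) (degree-CP v))

Turan-params : ∀ k → HasParams (Turan (2 * k + 2) (k + 1)) (2 * k) (4 * (k C 2))
Turan-params k rewrite +-comm k 1 =
  HasParams-of-privateSum CP (λ v → trans (degree-CP v) d≡) (λ v → trans (privateSum-CP v) d≡) identity
  where
  size : 2 * k + 2 ≡ suc k + suc k
  size = two-parts k
    where
    two-parts : ∀ k → 2 * k + 2 ≡ suc k + suc k
    two-parts = solve-∀
  open CocktailParty k size
  d≡ : 2 * k + 2 ∸ 2 ≡ 2 * k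
  d≡ = m+n∸n≡m (2 * k) 2
  identity : 2 * (4 * (k C 2)) + 2 * k ≡ 2 * k * (2 * k ∸ 1)
  identity = begin
    2 * (4 * (k C 2)) + 2 * k ≡⟨ ≡-sym (*-distribˡ-+ 2 (4 * (k C 2)) k) ⟩
    2 * (4 * (k C 2) + k)     ≡⟨ cong (2 *_) (≡-sym (double-C2 k)) ⟩
    2 * ((2 * k) C 2)         ≡⟨ 2*C2 (2 * k) ⟩
    2 * k * (2 * k ∸ 1)       ∎
    where open ≡-Reasoning

sumFin-++ : ∀ a {b} (f : Fin (a + b) → ℕ) → sumFin f ≡ sumFin (λ i → f (i ↑ˡ b)) + sumFin (λ i → f (a ↑ʳ i))
sumFin-++ zero    f = refl
sumFin-++ (suc a) f = trans (cong (f Fin.zero +_) (sumFin-++ a (λ i → f (Fin.suc i)))) (≡-sym (+-assoc (f Fin.zero) _ _))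

sumFin-remQuot : ∀ m n (g : Fin m × Fin n → ℕ) → sumFin {m * n} (g ∘ remQuot n) ≡ sumFin λ i → sumFin λ j → g (i , j)
sumFin-remQuot zero    n g = refl
sumFin-remQuot (suc m) n g = trans (sumFin-++ n (g ∘ remQuot {suc m} n))
  (cong₂ _+_ (sumFin-cong (λ j → cong g (first j)))
             (trans (sumFin-cong (λ i → cong g (rest i))) (sumFin-remQuot m n (λ (i , j) → g (Fin.suc i , j)))))
  where
  first : ∀ j → remQuot {suc m} n (j ↑ˡ (m * n)) ≡ (Fin.zero , j)
  first j rewrite splitAt-↑ˡ n j (m * n) = refl
  rest : ∀ i → remQuot {suc m} n (n ↑ʳ i) ≡ (Fin.suc (proj₁ (remQuot {m} n i)) , proj₂ (remQuot {m} n i))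
  rest i rewrite splitAt-↑ʳ n (m * n) i = refl

count-remQuot : ∀ m n (g : Fin m × Fin n → Bool) → count {m * n} (g ∘ remQuot n) ≡ sumFin λ i → count λ j → g (i , j)
count-remQuot m n g =
  trans (count≡sumFin (g ∘ remQuot n))
        (trans (sumFin-remQuot m n (χ ∘ g)) (sumFin-cong (λ i → ≡-sym (count≡sumFin (λ j → g (i , j))))))

_≐_ : ∀ {m n} → Fin m × Fin n → Fin m × Fin n → Bool
(i , j) ≐ (i′ , j′) = (i == i′) ∧ (j == j′)

≐-refl : ∀ {m n} (p : Fin m × Fin n) → p ≐ p ≡ true
≐-refl (i , j) = cong₂ _∧_ (==-refl i) (==-refl j)

≐⇒≡ : ∀ {m n} {p q : Fin m × Fin n} → p ≐ q ≡ true → p ≡ q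
≐⇒≡ {p = i , j} {i′ , j′} e with i == i′ in i=i′ | j == j′ in j=j′
... | true | true = cong₂ _,_ (==⇒≡ i=i′) (==⇒≡ j=j′)

remQuot-injective : ∀ {m} n {w x : Fin (m * n)} → remQuot {m} n w ≡ remQuot n x → w ≡ x
remQuot-injective {m} n {w} {x} e =
  trans (≡-sym (combine-remQuot {m} n w)) (trans (cong (uncurry combine) e) (combine-remQuot {m} n x))

==-remQuot : ∀ m n (w x : Fin (m * n)) → (w == x) ≡ (remQuot {m} n w ≐ remQuot n x)
==-remQuot m n w x with w == x in w=x
... | true with ==⇒≡ {i = w} {x} w=x
...   | refl = ≡-sym (≐-refl (remQuot {m} n w))
==-remQuot m n w x | false =
  ≡-sym (¬-not λ e → false≢true (trans (≡-sym w=x) (==-reflexive (remQuot-injective {m} n (≐⇒≡ e)))))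
  where
  ==-reflexive : w ≡ x → (w == x) ≡ true
  ==-reflexive refl = ==-refl w
  false≢true : false ≢ true
  false≢true ()

module Prism (M : ℕ) where

  P : Graph (M * 2)
  P = K M □ K 2
  open Neighbourhoods P

  pos : Fin (M * 2) → Fin M × Fin 2
  pos = remQuot 2

  -- definitionally the adjacency of P, read through pos
  E : Fin M × Fin 2 → Fin M × Fin 2 → Bool
  E (u , b) (u′ , b′) = ((u == u′) ∧ not (b == b′)) ∨ ((b == b′) ∧ not (u == u′))

  degree-P : ∀ v → degree P v ≡ M
  degree-P v = begin
    count (λ y → E (pos v) (pos y))                 ≡⟨ count-remQuot M 2 (E (pos v)) ⟩
    sumFin (λ u′ → count (λ b′ → E (pos v) (u′ , b′))) ≡⟨ sumFin-cong (one-per-layer (pos v)) ⟩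
    sumFin {M} (λ _ → 1)                            ≡⟨ trans (sumFin-const {M} 1) (*-identityʳ M) ⟩
    M                                               ∎
    where
    open ≡-Reasoning
    one-per-layer : ∀ p u′ → count {2} (λ b′ → E p (u′ , b′)) ≡ 1
    one-per-layer (u , Fin.zero) u′ with u == u′
    ... | true  = refl
    ... | false = refl
    one-per-layer (u , Fin.suc Fin.zero) u′ with u == u′
    ... | true  = refl
    ... | false = refl

  outside : Fin M × Fin 2 → Fin M × Fin 2 → Fin M × Fin 2 → Bool
  outside p q r = E p r ∧ not ((q ≐ r) ∨ E q r)

  privateCount : Fin M × Fin 2 → Fin M × Fin 2 → ℕ
  privateCount p q = sumFin λ u₂ → count λ b₂ → outside p q (u₂ , b₂)

  privateDegree-pos : ∀ v x → privateDegree v x ≡ privateCount (pos v) (pos x)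
  privateDegree-pos v x =
    trans (count-cong (λ w → cong (λ e → E (pos v) (pos w) ∧ not (e ∨ E (pos x) (pos w)))
                                  (trans (==-sym w x) (==-remQuot M 2 x w))))
          (count-remQuot M 2 (outside (pos v) (pos x)))

  privateCount-rung : ∀ u b b′ → (b == b′) ≡ false → privateCount (u , b) (u , b′) ≡ M ∸ 1
  privateCount-rung u b b′ b≠b′ =
    trans (sumFin-cong (row b b′ b≠b′)) (trans (≡-sym (count≡sumFin (λ u₂ → not (u == u₂)))) (degree-K M u))
    where
    row : ∀ b b′ → (b == b′) ≡ false → ∀ u₂ →
      count {2} (λ b₂ → outside (u , b) (u , b′) (u₂ , b₂)) ≡ χ (not (u == u₂))
    row Fin.zero (Fin.suc Fin.zero) _ u₂ with u == u₂
    ... | true  = refl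
    ... | false = refl
    row (Fin.suc Fin.zero) Fin.zero _ u₂ with u == u₂
    ... | true  = refl
    ... | false = refl
    row (Fin.suc Fin.zero) (Fin.suc Fin.zero) () u₂

  privateCount-layer : ∀ u u₁ b → (u == u₁) ≡ false → privateCount (u , b) (u₁ , b) ≡ 1
  privateCount-layer u u₁ b u≠u₁ =
    trans (sumFin-cong (λ u₂ → row b u₂ (distinct u₂))) (trans (≡-sym (count≡sumFin (u ==_))) (count-singletonˡ u))
    where
    distinct : ∀ u₂ → (u == u₂) ≡ true → (u₁ == u₂) ≡ false
    distinct u₂ u=u₂ with u₁ == u₂ in u₁=u₂
    ... | false = refl
    ... | true with ==⇒≡ {i = u} {u₂} u=u₂ | ==⇒≡ {i = u₁} {u₂} u₁=u₂
    ...   | refl | refl = trans (≡-sym (==-refl u)) u≠u₁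
    row : ∀ b u₂ → ((u == u₂) ≡ true → (u₁ == u₂) ≡ false) →
      count {2} (λ b₂ → outside (u , b) (u₁ , b) (u₂ , b₂)) ≡ χ (u == u₂)
    row b u₂ h with u == u₂ | u₁ == u₂ | h
    row b                  u₂ h | true  | true  | h′ with h′ refl
    ... | ()
    row Fin.zero           u₂ h | true  | false | _ = refl
    row Fin.zero           u₂ h | false | true  | _ = refl
    row Fin.zero           u₂ h | false | false | _ = refl
    row (Fin.suc Fin.zero) u₂ h | true  | false | _ = refl
    row (Fin.suc Fin.zero) u₂ h | false | true  | _ = refl
    row (Fin.suc Fin.zero) u₂ h | false | false | _ = refl

  layer-sum : ∀ u b u₁ →
    sumFin {2} (λ b₁ → if E (u , b) (u₁ , b₁) then privateCount (u , b) (u₁ , b₁) else 0)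
      ≡ (if u == u₁ then M ∸ 1 else 1)
  layer-sum u Fin.zero u₁ with u == u₁ in u=u₁
  ... | true with ==⇒≡ {i = u} {u₁} u=u₁
  ...   | refl = trans (+-identityʳ _) (privateCount-rung u Fin.zero (Fin.suc Fin.zero) refl)
  layer-sum u Fin.zero u₁ | false = trans (+-identityʳ _) (privateCount-layer u u₁ Fin.zero u=u₁)
  layer-sum u (Fin.suc Fin.zero) u₁ with u == u₁ in u=u₁
  ... | true with ==⇒≡ {i = u} {u₁} u=u₁
  ...   | refl = trans (+-identityʳ _) (privateCount-rung u (Fin.suc Fin.zero) Fin.zero refl)
  layer-sum u (Fin.suc Fin.zero) u₁ | false = trans (+-identityʳ _) (privateCount-layer u u₁ (Fin.suc Fin.zero) u=u₁)

  privateSum-P : ∀ v → privateSum v ≡ (M ∸ 1) + (M ∸ 1)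
  privateSum-P v = begin
    privateSum v
      ≡⟨ sumFin-cong (λ x → cong (if E (pos v) (pos x) then_else 0) (privateDegree-pos v x)) ⟩
    sumFin (λ x → g (pos x))
      ≡⟨ sumFin-remQuot M 2 g ⟩
    sumFin (λ u₁ → sumFin (λ b₁ → g (u₁ , b₁)))
      ≡⟨ sumFin-cong (layer-sum u b) ⟩
    sumFin (λ u₁ → if u == u₁ then M ∸ 1 else 1)
      ≡⟨ sumFin-cong (λ u₁ → split (u == u₁)) ⟩
    sumFin (λ u₁ → (if u == u₁ then M ∸ 1 else 0) + χ (not (u == u₁)))
      ≡⟨ sumFin-+ (λ u₁ → if u == u₁ then M ∸ 1 else 0) (λ u₁ → χ (not (u == u₁))) ⟩
    sumFin (λ u₁ → if u == u₁ then M ∸ 1 else 0) + sumFin (λ u₁ → χ (not (u == u₁)))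
      ≡⟨ cong₂ _+_ (trans (sumFin-if (u ==_) (M ∸ 1)) (trans (cong (_* (M ∸ 1)) (count-singletonˡ u)) (*-identityˡ (M ∸ 1))))
                   (trans (≡-sym (count≡sumFin (λ u₁ → not (u == u₁)))) (degree-K M u)) ⟩
    (M ∸ 1) + (M ∸ 1) ∎
    where
    open ≡-Reasoning
    u : Fin M
    u = proj₁ (pos v)
    b : Fin 2
    b = proj₂ (pos v)
    g : Fin M × Fin 2 → ℕ
    g q = if E (pos v) q then privateCount (pos v) q else 0
    split : ∀ c → (if c then M ∸ 1 else 1) ≡ (if c then M ∸ 1 else 0) + χ (not c)
    split true  = ≡-sym (+-identityʳ (M ∸ 1))
    split false = refl

prism-params : ∀ M → HasParams (K M □ K 2) M ((M ∸ 1) C 2)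
prism-params M = HasParams-of-privateSum P degree-P privateSum-P (begin
  2 * ((M ∸ 1) C 2) + ((M ∸ 1) + (M ∸ 1)) ≡⟨ cong (λ t → 2 * ((M ∸ 1) C 2) + ((M ∸ 1) + t)) (≡-sym (+-identityʳ (M ∸ 1))) ⟩
  2 * ((M ∸ 1) C 2) + 2 * (M ∸ 1)         ≡⟨ ≡-sym (*-pred≡2*C2+2*pred M) ⟩
  M * (M ∸ 1)                              ∎)
  where
  open Prism M
  open ≡-Reasoning

corollary5p1 : (k : ℕ) → 2 ≤ k →
    ((r₃ : ℕ) →
       ((4 * (k C 2) < r₃ × r₃ < (2 * k) C 2) ⊎ (((2 * k) ∸ 1) C 2 < r₃ × r₃ < 4 * (k C 2))) →
       ¬ (Σ ℕ λ n → Σ (Graph (suc n)) λ G → HasParams G (2 * k) r₃))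
    × HasParams (K (2 * k + 1)) (2 * k) ((2 * k) C 2)
    × HasParams (Turan (2 * k + 2) (k + 1)) (2 * k) (4 * (k C 2))
    × HasParams (K (2 * k) □ K 2) (2 * k) (((2 * k) ∸ 1) C 2)
corollary5p1 k _ = nonexistence , complete , Turan-params k , prism-params (2 * k)
  where
  complete : HasParams (K (2 * k + 1)) (2 * k) ((2 * k) C 2)
  complete = subst (λ d → HasParams (K (2 * k + 1)) d (d C 2)) (m+n∸n≡m (2 * k) 1) (K-params (2 * k + 1))
  nonexistence : (r : ℕ) → (4 * (k C 2) < r × r < (2 * k) C 2) ⊎ ((2 * k ∸ 1) C 2 < r × r < 4 * (k C 2)) →
    ¬ (Σ ℕ λ n → Σ (Graph (suc n)) λ G → HasParams G (2 * k) r)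
  nonexistence r gap (n , G , params) with even-degree-trichotomy {k = k} G params | gap
  ... | inj₁ refl        | inj₁ (_ , r<)  = <-irrefl refl r<
  ... | inj₁ refl        | inj₂ (_ , r<)  = <⇒≱ r< (4*C2≤double-C2 k)
  ... | inj₂ (inj₁ refl) | inj₁ (<r , _)  = <-irrefl refl <r
  ... | inj₂ (inj₁ refl) | inj₂ (_ , r<)  = <-irrefl refl r<
  ... | inj₂ (inj₂ r≤)   | inj₁ (<r , _)  = <⇒≱ <r (≤-trans r≤ (pred-double-C2≤4*C2 k))
  ... | inj₂ (inj₂ r≤)   | inj₂ (<r , _)  = <⇒≱ <r r≤
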